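{- For every sequent $S$: if $S$ has a proof in $(\mathsf{Grz}+\mathsf{cut})^\infty$, then $S$ has a proof in $\mathsf{Grz}^\infty$.
   Context: Formulas are built from propositional variables $p,q,\dots$, $\bot$, $\to$ and $\Box$. A sequent is a pair $(\Gamma,\Delta)$ of finite multisets of formulas; $S_0\cup S_1$ is componentwise multiset union; $S,\phi^\bullet$ means $S\cup(\{\phi\},\varnothing)$, $S,\phi^\circ$ means $S\cup(\varnothing,\{\phi\})$, and $S,\Gamma^\bullet$, $S,\Gamma^\circ$ analogously for multisets $\Gamma$; $\Box\Pi$ is $\{\Box\psi:\psi\in\Pi\}$. The rules of $\mathsf{Grz}^\infty$ (premises listed in order, as premise $0,1,\dots$): (Ax) no premises, conclusion $S,p^\bullet,p^\circ$; ($\bot^\bullet$) no premises, conclusion $S,\bot^\bullet$; ($\to^\bullet$) premises $S,\phi^\circ$ and $S,\psi^\bullet$, conclusion $S,(\phi\to\psi)^\bullet$; ($\to^\circ$) premise $S,\phi^\bullet,\psi^\circ$, conclusion $S,(\phi\to\psi)^\circ$; (Refl) premise $S,\phi^\bullet,\Box\phi^\bullet$, conclusion $S,\Box\phi^\bullet$; ($\Box$) premises $S,\Box\Pi^\bullet,\phi^\circ$ and $\Box\Pi^\bullet,\phi^\circ$, conclusion $S,\Box\Pi^\bullet,\Box\phi^\circ$. $(\mathsf{Grz}+\mathsf{cut})^\infty$ additionally has (cut) premises $S,\phi^\circ$ and $S,\phi^\bullet$, conclusion $S$. In both systems a proof of $S$ is a finitely branching, possibly infinite tree whose nodes are labelled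 by a sequent and a rule of the system, with root labelled $S$, such that each node with its children (in order) forms an instance of its rule, and such that every infinite branch passes infinitely often through a node that is the right premise (premise 1) of an instance of $(\Box)$ — this is the only progressing premise. -}

module Defs where

open import Data.Nat using (ℕ; zero; suc; _≤_; _<_)
open import Data.List using (List; []; _∷_; _++_; map; upTo)
open import Data.Product using (_×_; _,_; ∃; ∃-syntax; Σ-syntax)
open import Data.Empty using (⊥)
open import Data.Unit using (⊤)
open import Relation.Binary.PropositionalEquality using (_≡_)
open import Data.List.Relation.Binary.Permutation.Propositional using (_↭_)
open import Data.List.Relation.Binary.Pointwise using (Pointwise)

infixr 6 _⇒_
data Fm : Set where
  var : ℕ → Fm
  ⊥'  : Fm
  _⇒_ : Fm → Fm → Fm
  □_  : Fm → Fm

-- Sequents: pairs (Γ , Δ) of finite multisets, represented by lists;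
-- multiset equality is list permutation, componentwise.

Seq : Set
Seq = List Fm × List Fm

_≈ˢ_ : Seq → Seq → Set
(Γ , Δ) ≈ˢ (Γ' , Δ') = (Γ ↭ Γ') × (Δ ↭ Δ')

_∪_ : Seq → Seq → Seq
(Γ , Δ) ∪ (Γ' , Δ') = (Γ ++ Γ' , Δ ++ Δ')

infixl 5 _,•_ _,∘_ _,•*_
_,•_ : Seq → Fm → Seq
S ,• φ = S ∪ ((φ ∷ []) , [])

_,∘_ : Seq → Fm → Seq
S ,∘ φ = S ∪ ([] , (φ ∷ []))

_,•*_ : Seq → List Fm → Seq
S ,•* Γ = S ∪ (Γ , [])

□* : List Fm → List Fm
□* Π = map □_ Π

empty : Seq
empty = ([] , [])

data Rule : Set where
  ax bot• imp• imp∘ refl box cut : Rule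

arity : Rule → ℕ
arity ax   = 0
arity bot• = 0
arity imp• = 2
arity imp∘ = 1
arity refl = 1
arity box  = 2
arity cut  = 2

data Inst : Rule → Seq → List Seq → Set where
  i-ax   : ∀ S p → Inst ax (S ,• var p ,∘ var p) []
  i-bot  : ∀ S → Inst bot• (S ,• ⊥') []
  i-imp• : ∀ S φ ψ → Inst imp• (S ,• (φ ⇒ ψ)) ((S ,∘ φ) ∷ (S ,• ψ) ∷ [])
  i-imp∘ : ∀ S φ ψ → Inst imp∘ (S ,∘ (φ ⇒ ψ)) ((S ,• φ ,∘ ψ) ∷ [])
  i-refl : ∀ S φ → Inst refl (S ,• (□ φ)) ((S ,• φ ,• (□ φ)) ∷ [])
  i-box  : ∀ S Π φ → Inst box (S ,•* □* Π ,∘ (□ φ))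
                         ((S ,•* □* Π ,∘ φ) ∷ (empty ,•* □* Π ,∘ φ) ∷ [])
  i-cut  : ∀ S φ → Inst cut S ((S ,∘ φ) ∷ (S ,• φ) ∷ [])

InstM : Rule → Seq → List Seq → Set
InstM r C Ps = ∃[ C' ] ∃[ Ps' ] (Inst r C' Ps' × C ≈ˢ C' × Pointwise _≈ˢ_ Ps Ps')

data System : Set where
  Grz GrzCut : System

Allowed : System → Rule → Set
Allowed Grz    cut = ⊥
Allowed Grz    _   = ⊤
Allowed GrzCut _   = ⊤

-- Possibly infinite, finitely branching labelled trees.
-- Nodes are addresses (List ℕ); the address  i ∷ a  is the i-th child
-- (premise i) of the node a; the root is [].

path : (ℕ → ℕ) → ℕ → List ℕ
path β zero    = []
path β (suc n) = β n ∷ path β n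

record Proof (sys : System) (S : Seq) : Set₁ where
  field
    node     : List ℕ → Set
    seq      : List ℕ → Seq
    rule     : List ℕ → Rule
    root     : node []
    root-seq : seq [] ≡ S
    closed   : ∀ i a → node (i ∷ a) → node a
    children : ∀ a → node a → ∀ i → (node (i ∷ a) → i < arity (rule a))
                                   × (i < arity (rule a) → node (i ∷ a))
    allowed  : ∀ a → node a → Allowed sys (rule a)
    inst     : ∀ a → node a →
               InstM (rule a) (seq a) (map (λ i → seq (i ∷ a)) (upTo (arity (rule a))))
    fair     : ∀ (β : ℕ → ℕ) → (∀ n → node (path β n)) →
               ∀ n → ∃[ m ] (n ≤ m × rule (path β m) ≡ box × β m ≡ 1)

-- Both calculi are sound for finite trees, read as Kripke models whose
-- accessibility relation is the reflexive-transitive descendant order.  A tree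
-- refuting the conclusion of a rule refutes one of its premises; following
-- refuted premises, the tree never grows and becomes a proper subtree at each
-- right premise of (□) (this is where the Grz principle is used), so fairness
-- of a proof would give an infinite descent.  Conversely, a terminating
-- cut-free proof search either finds a finite derivation whose back edges all
-- enter right premises of (□), which unfolds into a Grz∞ proof, or builds a
-- finite tree refuting the sequent, which a (Grz + cut)∞ proof rules out.
module Submission where

open import Defs

open import Data.Bool using (T)
open import Data.Empty using (⊥; ⊥-elim)
open import Data.List using (List; []; _∷_; _++_; map; length; upTo; deduplicate)
open import Data.List.Membership.Propositional using (_∈_; find; lose)
open import Data.List.Membership.Propositional.Properties
  using (∈-++⁺ˡ; ∈-++⁺ʳ; ∈-++⁻; ∈-∃++; ∈-map⁺; ∈-deduplicate⁻; ∈-deduplicate⁺)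
open import Data.List.Properties using (length-++; map-++)
open import Data.List.Relation.Binary.Permutation.Propositional
  using (_↭_; ↭-refl; ↭-sym; ↭-trans; ↭-reflexive; prep)
open import Data.List.Relation.Binary.Permutation.Propositional.Properties
  using (All-resp-↭; ∈-resp-↭; shift; ++-comm; ++-identityʳ; ++-commutativeMonoid)
import Data.List.Relation.Binary.Permutation.Propositional.Properties as ↭
open import Data.List.Relation.Binary.Pointwise using ([]; _∷_)
open import Data.List.Relation.Binary.Subset.Propositional using (_⊆_)
open import Data.List.Relation.Unary.All as All using (All; []; _∷_)
open import Data.List.Relation.Unary.All.Properties
  using (¬All⇒Any¬; anti-mono; ++⁺; ++⁻ˡ; ++⁻ʳ; map⁺; map⁻; deduplicate⁺)
open import Data.List.Relation.Unary.Any as Any using (Any; here; there; any?)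
open import Data.List.Relation.Unary.Unique.Propositional using (Unique; []; _∷_)
open import Data.List.Relation.Unary.Unique.DecPropositional.Properties using (deduplicate-!)
open import Data.Maybe using (Maybe; just; nothing; is-just; maybe′; _>>=_)
open import Data.Nat using (ℕ; zero; suc; _+_; _⊔_; _≤_; _<_; _≤′_; ≤′-refl; ≤′-step; z≤n; s≤s)
open import Data.Nat.Induction using (<-wellFounded)
open import Data.Nat.ListAction using (sum)
open import Data.Nat.ListAction.Properties using (sum-↭)
open import Data.Nat.Properties
  using (≤-refl; ≤-reflexive; ≤-trans; ≤-antisym; <-≤-trans; <⇒≤; ≤⇒≤′; n≤1+n; m≤n⇒m≤1+n;
         m≤m+n; m≤n+m; m≤m⊔n; m≤n⊔m)
  renaming (_≟_ to _≟ℕ_)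
open import Data.Nat.Solver using (module +-*-Solver)
open import Data.Product using (_×_; _,_; proj₁; proj₂; Σ; ∃-syntax)
open import Data.Product.Relation.Binary.Lex.Strict using (×-Lex; ×-wellFounded)
open import Data.Sum as Sum using (_⊎_; inj₁; inj₂)
open import Data.Unit using (tt)
open import Function using (id; _∘_)
open import Induction.WellFounded using (Acc; acc)
open import Relation.Binary.Definitions using (DecidableEquality)
open import Relation.Binary.PropositionalEquality using (_≡_; refl; sym; trans; cong; subst)
open import Relation.Nullary using (¬_; Dec; yes; no; ¬?; _×-dec_; _→-dec_; contradiction)
open import Relation.Unary using (Decidable)

open import Data.List.Membership.DecPropositional _≟ℕ_ using () renaming (_∈?_ to _∈ℕ?_)
import Algebra.Solver.CommutativeMonoid (++-commutativeMonoid {A = Fm}) as ++-Solver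
open ++-Solver using (solve; _⊜_; _⊕_) renaming (id to ∅)
open +-*-Solver using (_:+_; _:=_; con) renaming (solve to solve-ℕ)

module _ (h : ℕ → ℕ) where

  no-infinite-descent : (∀ n → h (suc n) ≤ h n) →
                        (∀ n → ∃[ m ] (n ≤ m × h (suc m) < h m)) → ⊥
  no-infinite-descent h↓ drops = descend 0 (<-wellFounded (h 0))
    where
    antitone : ∀ {n m} → n ≤′ m → h m ≤ h n
    antitone ≤′-refl      = ≤-refl
    antitone (≤′-step n≤m) = ≤-trans (h↓ _) (antitone n≤m)

    descend : ∀ n → Acc _<_ (h n) → ⊥
    descend n (acc rec) with drops n
    ... | m , n≤m , drop = descend (suc m) (rec (<-≤-trans drop (antitone (≤⇒≤′ n≤m))))

  infinitely-often-by-descent : {P : ℕ → Set} → (∀ n → P n ⊎ h (suc n) < h n) →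
                                ∀ n → ∃[ m ] (n ≤ m × P m)
  infinitely-often-by-descent {P} step n = search n (<-wellFounded (h n))
    where
    search : ∀ n → Acc _<_ (h n) → ∃[ m ] (n ≤ m × P m)
    search n (acc rec) with step n
    ... | inj₁ p    = n , ≤-refl , p
    ... | inj₂ drop with search (suc n) (rec drop)
    ...   | m , n<m , p = m , ≤-trans (n≤1+n n) n<m , p

module _ {A : Set} where

  ∈⇒↭ : ∀ {x : A} {xs} → x ∈ xs → ∃[ ys ] xs ↭ x ∷ ys
  ∈⇒↭ x∈ with ys , zs , refl ← ∈-∃++ x∈ = ys ++ zs , shift _ ys zs

  unique-⊆⇒↭ : ∀ {ys xs : List A} → Unique ys → ys ⊆ xs → ∃[ zs ] xs ↭ ys ++ zs
  unique-⊆⇒↭ {[]}     {xs} []           _   = xs , ↭-refl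
  unique-⊆⇒↭ {y ∷ ys}      (y∉ys ∷ uniq) ⊆xs with ∈⇒↭ (⊆xs (here refl))
  ... | xs′ , xs↭ with unique-⊆⇒↭ uniq ys⊆xs′
    where
    ys⊆xs′ : ys ⊆ xs′
    ys⊆xs′ z∈ with ∈-resp-↭ xs↭ (⊆xs (there z∈))
    ... | here refl = contradiction refl (All.lookup y∉ys z∈)
    ... | there z∈′ = z∈′
  ... | zs , xs′↭ = zs , ↭-trans xs↭ (prep y xs′↭)

  first-or-all : ∀ {R : Set} {P : A → Set} {xs} → All (λ x → R ⊎ P x) xs → R ⊎ All P xs
  first-or-all []             = inj₂ []
  first-or-all (inj₁ r ∷ _)   = inj₁ r
  first-or-all (inj₂ p ∷ rps) = Sum.map₂ (p ∷_) (first-or-all rps)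

  collect : ∀ {B : Set} {K : B → Set} {Q : B → A → Set} {xs} →
            All (λ x → ∃[ b ] (K b × Q b x)) xs →
            ∃[ bs ] (All K bs × All (λ x → ∃[ b ] (b ∈ bs × Q b x)) xs)
  collect []                  = [] , [] , []
  collect ((b , kb , qb) ∷ w) with collect w
  ... | bs , kbs , qbs =
    b ∷ bs , kb ∷ kbs , (b , here refl , qb) ∷ All.map (λ (c , c∈ , qc) → c , there c∈ , qc) qbs

  count : ∀ {P : A → Set} → Decidable P → List A → ℕ
  count P? []       = zero
  count P? (x ∷ xs) with P? x
  ... | yes _ = suc (count P? xs)
  ... | no  _ = count P? xs

  module _ {P Q : A → Set} (P? : Decidable P) (Q? : Decidable Q) (Q⇒P : ∀ {x} → Q x → P x) where

    count-mono : ∀ xs → count Q? xs ≤ count P? xs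
    count-mono []       = z≤n
    count-mono (x ∷ xs) with P? x | Q? x
    ... | yes _  | yes _  = s≤s (count-mono xs)
    ... | yes _  | no  _  = m≤n⇒m≤1+n (count-mono xs)
    ... | no ¬px | yes qx = contradiction (Q⇒P qx) ¬px
    ... | no _   | no  _  = count-mono xs

    count-strict : ∀ {x} xs → x ∈ xs → P x → ¬ Q x → count Q? xs < count P? xs
    count-strict (y ∷ xs) (here refl) px ¬qx with P? y | Q? y
    ... | yes _  | yes qx = contradiction qx ¬qx
    ... | yes _  | no  _  = s≤s (count-mono xs)
    ... | no ¬px | _      = contradiction px ¬px
    count-strict (y ∷ xs) (there x∈) px ¬qx with P? y | Q? y
    ... | yes _  | yes _  = s≤s (count-strict xs x∈ px ¬qx)
    ... | yes _  | no  _  = m≤n⇒m≤1+n (count-strict xs x∈ px ¬qx)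
    ... | no ¬py | yes qy = contradiction (Q⇒P qy) ¬py
    ... | no _   | no  _  = count-strict xs x∈ px ¬qx

  count-cong : ∀ {P Q : A → Set} (P? : Decidable P) (Q? : Decidable Q) →
               (∀ {x} → P x → Q x) → (∀ {x} → Q x → P x) → ∀ xs → count P? xs ≡ count Q? xs
  count-cong P? Q? P⇒Q Q⇒P xs = ≤-antisym (count-mono Q? P? P⇒Q xs) (count-mono P? Q? Q⇒P xs)

_≟_ : DecidableEquality Fm
var p   ≟ var q     with p ≟ℕ q
... | yes refl = yes refl
... | no p≢q   = no λ { refl → p≢q refl }
⊥'      ≟ ⊥'        = yes refl
(φ ⇒ ψ) ≟ (φ′ ⇒ ψ′) with φ ≟ φ′ | ψ ≟ ψ′
... | yes refl | yes refl = yes refl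
... | no φ≢φ′  | _        = no λ { refl → φ≢φ′ refl }
... | yes _    | no ψ≢ψ′  = no λ { refl → ψ≢ψ′ refl }
(□ φ)   ≟ (□ ψ)     with φ ≟ ψ
... | yes refl = yes refl
... | no φ≢ψ   = no λ { refl → φ≢ψ refl }
var _   ≟ ⊥'        = no λ ()
var _   ≟ (_ ⇒ _)   = no λ ()
var _   ≟ (□ _)     = no λ ()
⊥'      ≟ var _     = no λ ()
⊥'      ≟ (_ ⇒ _)   = no λ ()
⊥'      ≟ (□ _)     = no λ ()
(_ ⇒ _) ≟ var _     = no λ ()
(_ ⇒ _) ≟ ⊥'        = no λ ()
(_ ⇒ _) ≟ (□ _)     = no λ ()
(□ _)   ≟ var _     = no λ ()
(□ _)   ≟ ⊥'        = no λ ()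
(□ _)   ≟ (_ ⇒ _)   = no λ ()

open import Data.List.Membership.DecPropositional _≟_ using (_∈?_)
open import Data.List.Relation.Binary.Subset.DecPropositional _≟_ using (_⊆?_)

subformulas : Fm → List Fm
subformulas (var p) = var p ∷ []
subformulas ⊥'      = ⊥' ∷ []
subformulas (φ ⇒ ψ) = (φ ⇒ ψ) ∷ subformulas φ ++ subformulas ψ
subformulas (□ φ)   = □ φ ∷ subformulas φ

∈-subformulas : ∀ φ → φ ∈ subformulas φ
∈-subformulas (var p) = here refl
∈-subformulas ⊥'      = here refl
∈-subformulas (φ ⇒ ψ) = here refl
∈-subformulas (□ φ)   = here refl

subformulas-trans : ∀ φ {ψ} → ψ ∈ subformulas φ → subformulas ψ ⊆ subformulas φ
subformulas-trans (var p) (here refl) = id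
subformulas-trans ⊥'      (here refl) = id
subformulas-trans (φ ⇒ ψ) (here refl) = id
subformulas-trans (φ ⇒ ψ) (there χ∈) with ∈-++⁻ (subformulas φ) χ∈
... | inj₁ χ∈φ = there ∘ ∈-++⁺ˡ ∘ subformulas-trans φ χ∈φ
... | inj₂ χ∈ψ = there ∘ ∈-++⁺ʳ (subformulas φ) ∘ subformulas-trans ψ χ∈ψ
subformulas-trans (□ φ)   (here refl) = id
subformulas-trans (□ φ)   (there χ∈)  = there ∘ subformulas-trans φ χ∈

SubformulaClosed : List Fm → Set
SubformulaClosed U = ∀ {φ} → φ ∈ U → subformulas φ ⊆ U

subformulas* : List Fm → List Fm
subformulas* []       = []
subformulas* (φ ∷ Fs) = subformulas φ ++ subformulas* Fs

subformulas*-closed : ∀ Fs → SubformulaClosed (subformulas* Fs)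
subformulas*-closed (φ ∷ Fs) ψ∈ with ∈-++⁻ (subformulas φ) ψ∈
... | inj₁ ψ∈φ  = ∈-++⁺ˡ ∘ subformulas-trans φ ψ∈φ
... | inj₂ ψ∈Fs = ∈-++⁺ʳ (subformulas φ) ∘ subformulas*-closed Fs ψ∈Fs

⊆-subformulas* : ∀ Fs → Fs ⊆ subformulas* Fs
⊆-subformulas* (φ ∷ Fs) (here refl) = ∈-++⁺ˡ (∈-subformulas φ)
⊆-subformulas* (φ ∷ Fs) (there ψ∈)  = ∈-++⁺ʳ (subformulas φ) (⊆-subformulas* Fs ψ∈)

≈ˢ-refl : ∀ {S} → S ≈ˢ S
≈ˢ-refl = ↭-refl , ↭-refl

≈ˢ-reflexive : ∀ {S S′} → S ≡ S′ → S ≈ˢ S′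
≈ˢ-reflexive refl = ≈ˢ-refl

≈ˢ-sym : ∀ {S S′} → S ≈ˢ S′ → S′ ≈ˢ S
≈ˢ-sym (Γ↭ , Δ↭) = ↭-sym Γ↭ , ↭-sym Δ↭

≈ˢ-trans : ∀ {S S′ S″} → S ≈ˢ S′ → S′ ≈ˢ S″ → S ≈ˢ S″
≈ˢ-trans (Γ↭ , Δ↭) (Γ↭′ , Δ↭′) = ↭-trans Γ↭ Γ↭′ , ↭-trans Δ↭ Δ↭′

•-head : ∀ Γ Δ φ → (φ ∷ Γ , Δ) ≈ˢ ((Γ , Δ) ,• φ)
•-head Γ Δ φ = ++-comm (φ ∷ []) Γ , ↭-sym (++-identityʳ Δ)

∘-head : ∀ Γ Δ φ → (Γ , φ ∷ Δ) ≈ˢ ((Γ , Δ) ,∘ φ)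
∘-head Γ Δ φ = ↭-sym (++-identityʳ Γ) , ++-comm (φ ∷ []) Δ

-- Finite tree models

data Tree : Set where
  tree : (valuation : List ℕ) (children : List Tree) → Tree

mutual
  descendants : Tree → List Tree
  descendants (tree _ ts) = nodes ts

  nodes : List Tree → List Tree
  nodes []       = []
  nodes (t ∷ ts) = t ∷ descendants t ++ nodes ts

valuation : Tree → List ℕ
valuation (tree v _) = v

size : Tree → ℕ
size = length ∘ descendants

infix 4 _⊩_ _⊮_ _⊩?_

_⊩_ : Tree → Fm → Set
t ⊩ var p   = p ∈ valuation t
_ ⊩ ⊥'      = ⊥
t ⊩ (φ ⇒ ψ) = t ⊩ φ → t ⊩ ψ
t ⊩ □ φ     = All (_⊩ φ) (t ∷ descendants t)

_⊮_ : Tree → Fm → Set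
t ⊮ φ = ¬ t ⊩ φ

_⊩?_ : ∀ t φ → Dec (t ⊩ φ)
t ⊩? var p   = p ∈ℕ? valuation t
_ ⊩? ⊥'      = no λ ()
t ⊩? (φ ⇒ ψ) = (t ⊩? φ) →-dec (t ⊩? ψ)
t ⊩? □ φ     = All.all? (_⊩? φ) (t ∷ descendants t)

mutual
  descendants-trans : ∀ t {d} → d ∈ descendants t → descendants d ⊆ descendants t
  descendants-trans (tree _ ts) = nodes-trans ts

  nodes-trans : ∀ ts {d} → d ∈ nodes ts → descendants d ⊆ nodes ts
  nodes-trans (t ∷ ts) (here refl) = there ∘ ∈-++⁺ˡ
  nodes-trans (t ∷ ts) (there d∈) with ∈-++⁻ (descendants t) d∈
  ... | inj₁ d∈t  = there ∘ ∈-++⁺ˡ ∘ descendants-trans t d∈t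
  ... | inj₂ d∈ts = there ∘ ∈-++⁺ʳ (descendants t) ∘ nodes-trans ts d∈ts

mutual
  descendant-smaller : ∀ t {d} → d ∈ descendants t → size d < size t
  descendant-smaller (tree _ ts) = node-smaller ts

  node-smaller : ∀ ts {d} → d ∈ nodes ts → size d < length (nodes ts)
  node-smaller (t ∷ ts) {d} d∈ = s≤s (≤-trans (bound d∈) (≤-reflexive (sym (length-++ (descendants t)))))
    where
    bound : d ∈ t ∷ descendants t ++ nodes ts → size d ≤ size t + length (nodes ts)
    bound (here refl) = m≤m+n _ _
    bound (there d∈′) with ∈-++⁻ (descendants t) d∈′
    ... | inj₁ d∈t  = ≤-trans (<⇒≤ (descendant-smaller t d∈t)) (m≤m+n _ _)
    ... | inj₂ d∈ts = ≤-trans (<⇒≤ (node-smaller ts d∈ts)) (m≤n+m _ _)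

□-persistent : ∀ t {d φ} → d ∈ descendants t → t ⊩ □ φ → d ⊩ □ φ
□-persistent t d∈ (_ ∷ below) = All.lookup below d∈ ∷ anti-mono (descendants-trans t d∈) below

_⊩↓_ : Tree → Fm → Set
t ⊩↓ φ = All (_⊩ φ) (descendants t)

∈-nodes : ∀ {t ts} → t ∈ ts → t ∈ nodes ts
∈-nodes (here refl) = here refl
∈-nodes {ts = t ∷ ts} (there t∈) = there (∈-++⁺ʳ (descendants t) (∈-nodes t∈))

□-forest⇒nodes : ∀ {ts ψ} → All (_⊩ □ ψ) ts → All (_⊩ ψ) (nodes ts)
□-forest⇒nodes []                  = []
□-forest⇒nodes ((tψ ∷ below) ∷ ts□) = tψ ∷ ++⁺ below (□-forest⇒nodes ts□)

child-refutes-□ : ∀ {v ts t φ} → t ∈ ts → t ⊮ φ → tree v ts ⊮ □ φ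
child-refutes-□ t∈ t⊮φ (_ ∷ below) = t⊮φ (All.lookup below (∈-nodes t∈))

□-refuted-below : ∀ t {φ} → t ⊩ φ → t ⊮ □ φ → ∃[ d ] (d ∈ descendants t × d ⊮ φ)
□-refuted-below t {φ} tφ t⊮□φ =
  find (¬All⇒Any¬ (_⊩? φ) (descendants t) (λ below → t⊮□φ (tφ ∷ below)))

infix 4 _⊭_

_⊭_ : Tree → Seq → Set
t ⊭ (Γ , Δ) = All (t ⊩_) Γ × All (t ⊮_) Δ

⊭-resp-≈ˢ : ∀ {t S S′} → S ≈ˢ S′ → t ⊭ S → t ⊭ S′
⊭-resp-≈ˢ (Γ↭ , Δ↭) (Γ✓ , Δ✗) = All-resp-↭ Γ↭ Γ✓ , All-resp-↭ Δ↭ Δ✗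

module _ {t : Tree} where

  ⊭-∪⁻ : ∀ S {S′} → t ⊭ (S ∪ S′) → t ⊭ S × t ⊭ S′
  ⊭-∪⁻ (Γ , Δ) (Γ✓ , Δ✗) = (++⁻ˡ Γ Γ✓ , ++⁻ˡ Δ Δ✗) , (++⁻ʳ Γ Γ✓ , ++⁻ʳ Δ Δ✗)

  ⊭-∪⁺ : ∀ {S S′} → t ⊭ S → t ⊭ S′ → t ⊭ (S ∪ S′)
  ⊭-∪⁺ (Γ✓ , Δ✗) (Γ′✓ , Δ′✗) = ++⁺ Γ✓ Γ′✓ , ++⁺ Δ✗ Δ′✗

  ⊭-•⁻ : ∀ S {φ} → t ⊭ (S ,• φ) → t ⊭ S × t ⊩ φ
  ⊭-•⁻ S r with ⊭-∪⁻ S r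
  ... | rS , (tφ ∷ [] , []) = rS , tφ

  ⊭-∘⁻ : ∀ S {φ} → t ⊭ (S ,∘ φ) → t ⊭ S × t ⊮ φ
  ⊭-∘⁻ S r with ⊭-∪⁻ S r
  ... | rS , ([] , t⊮φ ∷ []) = rS , t⊮φ

  ⊭-•⁺ : ∀ {S φ} → t ⊭ S → t ⊩ φ → t ⊭ (S ,• φ)
  ⊭-•⁺ rS tφ = ⊭-∪⁺ rS (tφ ∷ [] , [])

  ⊭-∘⁺ : ∀ {S φ} → t ⊭ S → t ⊮ φ → t ⊭ (S ,∘ φ)
  ⊭-∘⁺ rS t⊮φ = ⊭-∪⁺ rS ([] , t⊮φ ∷ [])

-- Soundness

record RefutedPremise (r : Rule) (premises : ℕ → Seq) (t : Tree) : Set where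
  constructor at-premise
  field
    index       : ℕ
    isPremise   : index < arity r
    model       : Tree
    refutes     : model ⊭ premises index
    no-larger   : size model ≤ size t
    progressing : r ≡ box → index ≡ 1 → size model < size t

local-soundness : ∀ {r C} premises → InstM r C (map premises (upTo (arity r))) →
                  ∀ {t} → t ⊭ C → RefutedPremise r premises t
local-soundness _ (_ , _ , i-ax S p , C≈ , []) r
  with ⊭-∘⁻ (S ,• var p) (⊭-resp-≈ˢ C≈ r)
... | rS , t⊮p = ⊥-elim (t⊮p (proj₂ (⊭-•⁻ S rS)))
local-soundness _ (_ , _ , i-bot S , C≈ , []) r = ⊥-elim (proj₂ (⊭-•⁻ S (⊭-resp-≈ˢ C≈ r)))
local-soundness _ (_ , _ , i-imp• S φ ψ , C≈ , P₀≈ ∷ P₁≈ ∷ []) {t} r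
  with ⊭-•⁻ S (⊭-resp-≈ˢ C≈ r)
... | rS , tφ⇒ψ with t ⊩? φ
...   | no t⊮φ = at-premise 0 (s≤s z≤n) t (⊭-resp-≈ˢ (≈ˢ-sym P₀≈) (⊭-∘⁺ rS t⊮φ)) ≤-refl λ ()
...   | yes tφ = at-premise 1 (s≤s (s≤s z≤n)) t (⊭-resp-≈ˢ (≈ˢ-sym P₁≈) (⊭-•⁺ rS (tφ⇒ψ tφ))) ≤-refl λ ()
local-soundness _ (_ , _ , i-imp∘ S φ ψ , C≈ , P₀≈ ∷ []) {t} r
  with ⊭-∘⁻ S (⊭-resp-≈ˢ C≈ r)
... | rS , t⊮φ⇒ψ with t ⊩? φ
...   | no t⊮φ = ⊥-elim (t⊮φ⇒ψ (⊥-elim ∘ t⊮φ))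
...   | yes tφ = at-premise 0 (s≤s z≤n) t
                   (⊭-resp-≈ˢ (≈ˢ-sym P₀≈) (⊭-∘⁺ (⊭-•⁺ rS tφ) (t⊮φ⇒ψ ∘ λ tψ _ → tψ))) ≤-refl λ ()
local-soundness _ (_ , _ , i-refl S φ , C≈ , P₀≈ ∷ []) {t} r
  with ⊭-•⁻ S (⊭-resp-≈ˢ C≈ r)
... | rS , t□φ@(tφ ∷ _) =
  at-premise 0 (s≤s z≤n) t (⊭-resp-≈ˢ (≈ˢ-sym P₀≈) (⊭-•⁺ (⊭-•⁺ rS tφ) t□φ)) ≤-refl λ ()
local-soundness _ (_ , _ , i-box S Π φ , C≈ , P₀≈ ∷ P₁≈ ∷ []) {t} r
  with ⊭-∘⁻ (S ,•* □* Π) (⊭-resp-≈ˢ C≈ r)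
... | rSΠ , t⊮□φ with t ⊩? φ
...   | no t⊮φ = at-premise 0 (s≤s z≤n) t (⊭-resp-≈ˢ (≈ˢ-sym P₀≈) (⊭-∘⁺ rSΠ t⊮φ)) ≤-refl λ _ ()
...   | yes tφ with □-refuted-below t tφ t⊮□φ
...     | d , d∈ , d⊮φ =
        at-premise 1 (s≤s (s≤s z≤n)) d (⊭-resp-≈ˢ (≈ˢ-sym P₁≈) (⊭-∘⁺ (d□Π , []) d⊮φ))
                   (<⇒≤ (descendant-smaller t d∈)) λ _ _ → descendant-smaller t d∈
  where
  d□Π : All (d ⊩_) (□* Π)
  d□Π = map⁺ (All.map (□-persistent t d∈) (map⁻ (proj₁ (proj₂ (⊭-∪⁻ S rSΠ)))))
local-soundness _ (_ , _ , i-cut S φ , C≈ , P₀≈ ∷ P₁≈ ∷ []) {t} r with t ⊩? φ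
... | no t⊮φ =
  at-premise 0 (s≤s z≤n) t (⊭-resp-≈ˢ (≈ˢ-sym P₀≈) (⊭-∘⁺ (⊭-resp-≈ˢ C≈ r) t⊮φ)) ≤-refl λ ()
... | yes tφ =
  at-premise 1 (s≤s (s≤s z≤n)) t (⊭-resp-≈ˢ (≈ˢ-sym P₁≈) (⊭-•⁺ (⊭-resp-≈ˢ C≈ r) tφ)) ≤-refl λ ()

module _ {sys S} (P : Proof sys S) where
  open Proof P
  open RefutedPremise

  record Refuted (a : List ℕ) : Set where
    field
      on-tree : node a
      model   : Tree
      refutes : model ⊭ seq a
  open Refuted

  refutation-step : ∀ {a} (x : Refuted a) → RefutedPremise (rule a) (λ i → seq (i ∷ a)) (model x)
  refutation-step x = local-soundness _ (inst _ (on-tree x)) (refutes x)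

  refuted-premise : ∀ {a} (x : Refuted a) → Refuted (index (refutation-step x) ∷ a)
  refuted-premise x = record
    { on-tree = proj₂ (children _ (on-tree x) _) (isPremise (refutation-step x))
    ; model   = RefutedPremise.model (refutation-step x)
    ; refutes = RefutedPremise.refutes (refutation-step x)
    }

  soundness : ∀ t → ¬ t ⊭ S
  soundness t t⊭S = no-infinite-descent h (λ n → no-larger (refutation-step (proj₂ (walk n)))) drops
    where
    walk : ℕ → Σ (List ℕ) Refuted
    walk zero    = [] , record { on-tree = root ; model = t ; refutes = subst (t ⊭_) (sym root-seq) t⊭S }
    walk (suc n) = let (a , x) = walk n in index (refutation-step x) ∷ a , refuted-premise x

    β : ℕ → ℕ
    β n = index (refutation-step (proj₂ (walk n)))

    walk-follows-β : ∀ n → proj₁ (walk n) ≡ path β n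
    walk-follows-β zero    = refl
    walk-follows-β (suc n) = cong (β n ∷_) (walk-follows-β n)

    h : ℕ → ℕ
    h n = size (model (proj₂ (walk n)))

    drops : ∀ n → ∃[ m ] (n ≤ m × h (suc m) < h m)
    drops n with fair β (λ m → subst node (walk-follows-β m) (on-tree (proj₂ (walk m)))) n
    ... | m , n≤m , box-rule , right-premise =
      m , n≤m , progressing (refutation-step (proj₂ (walk m)))
                  (subst (λ a → rule a ≡ box) (sym (walk-follows-β m)) box-rule) right-premise

-- Cyclic derivations and their unfolding

BoxGoal : Set
BoxGoal = List Fm × Fm

boxPremise : BoxGoal → Seq
boxPremise (Π , φ) = empty ,•* □* Π ,∘ φ

-- The right premise of (□) may be a back edge to an enclosing goal recorded in H.  These are the
-- only cycles, so every infinite branch of the unfolding passes through right premises of (□).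
data Cyclic (H : List BoxGoal) : Seq → Set
data BoxPremise (H : List BoxGoal) : BoxGoal → Set

data Cyclic H where
  c-ax   : ∀ {C} S p → C ≈ˢ (S ,• var p ,∘ var p) → Cyclic H C
  c-bot  : ∀ {C} S → C ≈ˢ (S ,• ⊥') → Cyclic H C
  c-imp• : ∀ {C} S φ ψ → C ≈ˢ (S ,• (φ ⇒ ψ)) → Cyclic H (S ,∘ φ) → Cyclic H (S ,• ψ) → Cyclic H C
  c-imp∘ : ∀ {C} S φ ψ → C ≈ˢ (S ,∘ (φ ⇒ ψ)) → Cyclic H (S ,• φ ,∘ ψ) → Cyclic H C
  c-refl : ∀ {C} S φ → C ≈ˢ (S ,• (□ φ)) → Cyclic H (S ,• φ ,• (□ φ)) → Cyclic H C
  c-box  : ∀ {C} S Π φ → C ≈ˢ (S ,•* □* Π ,∘ (□ φ)) →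
           Cyclic H (S ,•* □* Π ,∘ φ) → BoxPremise H (Π , φ) → Cyclic H C

data BoxPremise H where
  back : ∀ {G} → G ∈ H → BoxPremise H G
  new  : ∀ {G} → Cyclic (G ∷ H) (boxPremise G) → BoxPremise H G

data Companions : List BoxGoal → Set where
  []  : Companions []
  _∷_ : ∀ {G H} → Cyclic (G ∷ H) (boxPremise G) → Companions H → Companions (G ∷ H)

companion : ∀ {G H} → G ∈ H → Companions H → ∃[ H′ ] (Cyclic (G ∷ H′) (boxPremise G) × Companions H′)
companion (here refl) (d ∷ ds) = _ , d , ds
companion (there G∈) (_ ∷ ds) = companion G∈ ds

cyclic-≈ˢ : ∀ {H C C′} → C ≈ˢ C′ → Cyclic H C′ → Cyclic H C
cyclic-≈ˢ C≈ (c-ax S p C′≈)           = c-ax S p (≈ˢ-trans C≈ C′≈)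
cyclic-≈ˢ C≈ (c-bot S C′≈)            = c-bot S (≈ˢ-trans C≈ C′≈)
cyclic-≈ˢ C≈ (c-imp• S φ ψ C′≈ d d′)  = c-imp• S φ ψ (≈ˢ-trans C≈ C′≈) d d′
cyclic-≈ˢ C≈ (c-imp∘ S φ ψ C′≈ d)     = c-imp∘ S φ ψ (≈ˢ-trans C≈ C′≈) d
cyclic-≈ˢ C≈ (c-refl S φ C′≈ d)       = c-refl S φ (≈ˢ-trans C≈ C′≈) d
cyclic-≈ˢ C≈ (c-box S Π φ C′≈ d r)    = c-box S Π φ (≈ˢ-trans C≈ C′≈) d r

record State : Set where
  constructor state
  field
    {history}    : List BoxGoal
    companions   : Companions history
    {conclusion} : Seq
    derivation   : Cyclic history conclusion
open State

enter : ∀ {H G} → BoxPremise H G → Companions H → State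
enter (new d)   ds = state (d ∷ ds) d
enter (back G∈) ds with companion G∈ ds
... | _ , d , ds′ = state (d ∷ ds′) d

enter-conclusion : ∀ {H G} (r : BoxPremise H G) ds → conclusion (enter r ds) ≡ boxPremise G
enter-conclusion (new d)   ds = refl
enter-conclusion (back G∈) ds with companion G∈ ds
... | _ , d , ds′ = refl

rule-of : State → Rule
rule-of (state _ (c-ax _ _ _))           = ax
rule-of (state _ (c-bot _ _))            = bot•
rule-of (state _ (c-imp• _ _ _ _ _ _))   = imp•
rule-of (state _ (c-imp∘ _ _ _ _ _))     = imp∘
rule-of (state _ (c-refl _ _ _ _))       = refl
rule-of (state _ (c-box _ _ _ _ _ _))    = box

premise : State → ℕ → Maybe State
premise (state ds (c-imp• _ _ _ _ d _)) 0 = just (state ds d)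
premise (state ds (c-imp• _ _ _ _ _ d)) 1 = just (state ds d)
premise (state ds (c-imp∘ _ _ _ _ d))   0 = just (state ds d)
premise (state ds (c-refl _ _ _ d))     0 = just (state ds d)
premise (state ds (c-box _ _ _ _ d _))  0 = just (state ds d)
premise (state ds (c-box _ _ _ _ _ r))  1 = just (enter r ds)
premise _                                _ = nothing

Defined : Maybe State → Set
Defined = T ∘ is-just

premise-defined⇔ : ∀ s i → (Defined (premise s i) → i < arity (rule-of s)) ×
                           (i < arity (rule-of s) → Defined (premise s i))
premise-defined⇔ (state _ (c-ax _ _ _))           i             = (λ ()) , (λ ())
premise-defined⇔ (state _ (c-bot _ _))            i             = (λ ()) , (λ ())
premise-defined⇔ (state _ (c-imp• _ _ _ _ _ _))   0             = (λ _ → s≤s z≤n) , (λ _ → tt)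
premise-defined⇔ (state _ (c-imp• _ _ _ _ _ _))   1             = (λ _ → s≤s (s≤s z≤n)) , (λ _ → tt)
premise-defined⇔ (state _ (c-imp• _ _ _ _ _ _))   (suc (suc i)) = (λ ()) , (λ { (s≤s (s≤s ())) })
premise-defined⇔ (state _ (c-imp∘ _ _ _ _ _))     0             = (λ _ → s≤s z≤n) , (λ _ → tt)
premise-defined⇔ (state _ (c-imp∘ _ _ _ _ _))     (suc i)       = (λ ()) , (λ { (s≤s ()) })
premise-defined⇔ (state _ (c-refl _ _ _ _))       0             = (λ _ → s≤s z≤n) , (λ _ → tt)
premise-defined⇔ (state _ (c-refl _ _ _ _))       (suc i)       = (λ ()) , (λ { (s≤s ()) })
premise-defined⇔ (state _ (c-box _ _ _ _ _ _))    0             = (λ _ → s≤s z≤n) , (λ _ → tt)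
premise-defined⇔ (state _ (c-box _ _ _ _ _ _))    1             = (λ _ → s≤s (s≤s z≤n)) , (λ _ → tt)
premise-defined⇔ (state _ (c-box _ _ _ _ _ _))    (suc (suc i)) = (λ ()) , (λ { (s≤s (s≤s ())) })

conclusion? : Maybe State → Seq
conclusion? = maybe′ conclusion empty

rule-of? : Maybe State → Rule
rule-of? = maybe′ rule-of ax

premise? : Maybe State → ℕ → Maybe State
premise? m i = m >>= λ s → premise s i

state-instance : ∀ s →
                 InstM (rule-of s) (conclusion s) (map (conclusion? ∘ premise s) (upTo (arity (rule-of s))))
state-instance (state _ (c-ax S p C≈))          = _ , _ , i-ax S p , C≈ , []
state-instance (state _ (c-bot S C≈))           = _ , _ , i-bot S , C≈ , []
state-instance (state _ (c-imp• S φ ψ C≈ _ _))  = _ , _ , i-imp• S φ ψ , C≈ , ≈ˢ-refl ∷ ≈ˢ-refl ∷ []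
state-instance (state _ (c-imp∘ S φ ψ C≈ _))    = _ , _ , i-imp∘ S φ ψ , C≈ , ≈ˢ-refl ∷ []
state-instance (state _ (c-refl S φ C≈ _))      = _ , _ , i-refl S φ , C≈ , ≈ˢ-refl ∷ []
state-instance (state ds (c-box S Π φ C≈ _ r))  =
  _ , _ , i-box S Π φ , C≈ , ≈ˢ-refl ∷ ≈ˢ-reflexive (enter-conclusion r ds) ∷ []

cut-free : ∀ s → Allowed Grz (rule-of s)
cut-free (state _ (c-ax _ _ _))         = tt
cut-free (state _ (c-bot _ _))          = tt
cut-free (state _ (c-imp• _ _ _ _ _ _)) = tt
cut-free (state _ (c-imp∘ _ _ _ _ _))   = tt
cut-free (state _ (c-refl _ _ _ _))     = tt
cut-free (state _ (c-box _ _ _ _ _ _))  = tt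

-- Right premises of (□) are not counted, so every other step into a premise lowers the height.
height : ∀ {H C} → Cyclic H C → ℕ
height (c-ax _ _ _)           = 0
height (c-bot _ _)            = 0
height (c-imp• _ _ _ _ d d′)  = suc (height d ⊔ height d′)
height (c-imp∘ _ _ _ _ d)     = suc (height d)
height (c-refl _ _ _ d)       = suc (height d)
height (c-box _ _ _ _ d _)    = suc (height d)

progress-or-lower : ∀ s i {s′} → premise s i ≡ just s′ →
                    (rule-of s ≡ box × i ≡ 1) ⊎ height (derivation s′) < height (derivation s)
progress-or-lower (state _ (c-imp• _ _ _ _ d d′)) 0 refl = inj₂ (s≤s (m≤m⊔n (height d) (height d′)))
progress-or-lower (state _ (c-imp• _ _ _ _ d d′)) 1 refl = inj₂ (s≤s (m≤n⊔m (height d) (height d′)))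
progress-or-lower (state _ (c-imp∘ _ _ _ _ _))   0 refl = inj₂ ≤-refl
progress-or-lower (state _ (c-refl _ _ _ _))     0 refl = inj₂ ≤-refl
progress-or-lower (state _ (c-box _ _ _ _ _ _))  0 refl = inj₂ ≤-refl
progress-or-lower (state _ (c-box _ _ _ _ _ _))  1 _    = inj₁ (refl , refl)
progress-or-lower (state _ (c-ax _ _ _))         _             ()
progress-or-lower (state _ (c-bot _ _))          _             ()
progress-or-lower (state _ (c-imp• _ _ _ _ _ _)) (suc (suc _)) ()
progress-or-lower (state _ (c-imp∘ _ _ _ _ _))   (suc _)       ()
progress-or-lower (state _ (c-refl _ _ _ _))     (suc _)       ()
progress-or-lower (state _ (c-box _ _ _ _ _ _))  (suc (suc _)) ()

defined⇒just : ∀ (m : Maybe State) → Defined m → ∃[ s ] m ≡ just s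
defined⇒just (just s) _ = s , refl

module Unfolding {S} (d : Cyclic [] S) where

  at : List ℕ → Maybe State
  at []      = just (state [] d)
  at (i ∷ a) = premise? (at a) i

  Progress : (ℕ → ℕ) → ℕ → Set
  Progress β m = rule-of? (at (path β m)) ≡ box × β m ≡ 1

  fairness : ∀ β → (∀ n → Defined (at (path β n))) → ∀ n → ∃[ m ] (n ≤ m × Progress β m)
  fairness β on-path = infinitely-often-by-descent h progress-or-drop
    where
    state-at : ∀ n → ∃[ s ] at (path β n) ≡ just s
    state-at n = defined⇒just _ (on-path n)

    h : ℕ → ℕ
    h n = height (derivation (proj₁ (state-at n)))

    progress-or-drop : ∀ n → Progress β n ⊎ h (suc n) < h n
    progress-or-drop n with state-at n | state-at (suc n)
    ... | s , at-n | _ , at-sn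
      with progress-or-lower s (β n) (trans (sym (cong (λ m → premise? m (β n)) at-n)) at-sn)
    ...   | inj₁ (box-rule , right) = inj₁ (trans (cong rule-of? at-n) box-rule , right)
    ...   | inj₂ lower              = inj₂ lower

  unfold : Proof Grz S
  unfold = record
    { node     = Defined ∘ at
    ; seq      = conclusion? ∘ at
    ; rule     = rule-of? ∘ at
    ; root     = tt
    ; root-seq = refl
    ; closed   = λ i a → parent-defined (at a) i
    ; children = λ a → premises-defined (at a)
    ; allowed  = λ a → allowed (at a)
    ; inst     = λ a → instance-at (at a)
    ; fair     = fairness
    }
    where
    parent-defined : ∀ m i → Defined (premise? m i) → Defined m
    parent-defined (just _) _ _ = tt

    premises-defined : ∀ m → Defined m → ∀ i → (Defined (premise? m i) → i < arity (rule-of? m)) ×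
                                               (i < arity (rule-of? m) → Defined (premise? m i))
    premises-defined (just s) _ = premise-defined⇔ s

    allowed : ∀ m → Defined m → Allowed Grz (rule-of? m)
    allowed (just s) _ = cut-free s

    instance-at : ∀ m → Defined m →
                  InstM (rule-of? m) (conclusion? m)
                        (map (conclusion? ∘ premise? m) (upTo (arity (rule-of? m))))
    instance-at (just s) _ = state-instance s

-- Proof search

data Atomic : Fm → Set where
  is-var : ∀ p → Atomic (var p)
  is-⊥   : Atomic ⊥'

-- Γ, Δ: formulas still to be decomposed; A, X: atoms on the left and right;
-- B, R: bodies of the boxed formulas on the left and right.
sequent : List Fm → List ℕ → List Fm → List Fm → List Fm → List Fm → Seq
sequent Γ A B Δ X R = (Γ ++ map var A ++ □* B , Δ ++ X ++ □* R)

-- □ B is only required strictly below t; □-left supplies the bodies at t itself.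
Refutes : Tree → List Fm → List ℕ → List Fm → List Fm → List Fm → List Fm → Set
Refutes t Γ A B Δ X R = All (t ⊩_) (Γ ++ map var A) × All (t ⊩↓_) B × All (t ⊮_) (Δ ++ X ++ □* R)

data LocalOutcome (H : List BoxGoal) (Γ : List Fm) (A : List ℕ) (B Δ X R : List Fm) : Set where
  proved  : Cyclic H (sequent Γ A B Δ X R) → LocalOutcome H Γ A B Δ X R
  refuted : ∀ t → Refutes t Γ A B Δ X R → LocalOutcome H Γ A B Δ X R

data Outcome (H : List BoxGoal) (S : Seq) : Set where
  proved  : Cyclic H S → Outcome H S
  refuted : ∀ t → t ⊭ S → Outcome H S

module _ {H : List BoxGoal} {Γ : List Fm} {A : List ℕ} {B Δ X R : List Fm} where

  var-left : ∀ {p} → LocalOutcome H Γ (p ∷ A) B Δ X R → LocalOutcome H (var p ∷ Γ) A B Δ X R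
  var-left {p} (proved d) = proved (cyclic-≈ˢ (↭-sym (shift (var p) Γ (map var A ++ □* B)) , ↭-refl) d)
  var-left {p} (refuted t (Γ✓ , B✓ , Δ✗)) =
    refuted t (All-resp-↭ (shift (var p) Γ (map var A)) Γ✓ , B✓ , Δ✗)

  ⊥-left : LocalOutcome H (⊥' ∷ Γ) A B Δ X R
  ⊥-left = proved (c-bot (sequent Γ A B Δ X R) (•-head _ _ ⊥'))

  ⇒-left : ∀ {φ ψ} → LocalOutcome H Γ A B (φ ∷ Δ) X R → LocalOutcome H (ψ ∷ Γ) A B Δ X R →
           LocalOutcome H ((φ ⇒ ψ) ∷ Γ) A B Δ X R
  ⇒-left (refuted t (Γ✓ , B✓ , t⊮φ ∷ Δ✗)) _ = refuted t ((⊥-elim ∘ t⊮φ) ∷ Γ✓ , B✓ , Δ✗)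
  ⇒-left (proved _) (refuted t (tψ ∷ Γ✓ , B✓ , Δ✗)) = refuted t ((λ _ → tψ) ∷ Γ✓ , B✓ , Δ✗)
  ⇒-left {φ} {ψ} (proved d) (proved d′) = proved (c-imp• S φ ψ (•-head _ _ (φ ⇒ ψ))
    (cyclic-≈ˢ (≈ˢ-sym (∘-head _ _ φ)) d) (cyclic-≈ˢ (≈ˢ-sym (•-head _ _ ψ)) d′))
    where S = sequent Γ A B Δ X R

  □-left : ∀ {φ} → LocalOutcome H (φ ∷ Γ) A (φ ∷ B) Δ X R → LocalOutcome H (□ φ ∷ Γ) A B Δ X R
  □-left (refuted t (tφ ∷ Γ✓ , below ∷ B✓ , Δ✗)) = refuted t ((tφ ∷ below) ∷ Γ✓ , B✓ , Δ✗)
  □-left {φ} (proved d) = proved (c-refl (sequent Γ A B Δ X R) φ (•-head _ _ (□ φ)) (cyclic-≈ˢ premise≈ d))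
    where
    premise≈ : (sequent Γ A B Δ X R ,• φ ,• □ φ) ≈ˢ sequent (φ ∷ Γ) A (φ ∷ B) Δ X R
    premise≈ = solve 5 (λ g a b f bf → ((g ⊕ (a ⊕ b)) ⊕ f) ⊕ bf ⊜ f ⊕ (g ⊕ (a ⊕ (bf ⊕ b))))
                 ↭-refl Γ (map var A) (□* B) (φ ∷ []) (□ φ ∷ [])
             , ↭-trans (++-identityʳ _) (++-identityʳ _)

  atom-right : ∀ {χ} → LocalOutcome H Γ A B Δ (χ ∷ X) R → LocalOutcome H Γ A B (χ ∷ Δ) X R
  atom-right {χ} (proved d) = proved (cyclic-≈ˢ (↭-refl , ↭-sym (shift χ Δ (X ++ □* R))) d)
  atom-right {χ} (refuted t (Γ✓ , B✓ , Δ✗)) = refuted t (Γ✓ , B✓ , All-resp-↭ (shift χ Δ (X ++ □* R)) Δ✗)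

  ⇒-right : ∀ {φ ψ} → LocalOutcome H (φ ∷ Γ) A B (ψ ∷ Δ) X R → LocalOutcome H Γ A B ((φ ⇒ ψ) ∷ Δ) X R
  ⇒-right (refuted t (tφ ∷ Γ✓ , B✓ , t⊮ψ ∷ Δ✗)) = refuted t (Γ✓ , B✓ , (λ tφ⇒ψ → t⊮ψ (tφ⇒ψ tφ)) ∷ Δ✗)
  ⇒-right {φ} {ψ} (proved d) =
    proved (c-imp∘ (sequent Γ A B Δ X R) φ ψ (∘-head _ _ (φ ⇒ ψ)) (cyclic-≈ˢ premise≈ d))
    where
    premise≈ : (sequent Γ A B Δ X R ,• φ ,∘ ψ) ≈ˢ sequent (φ ∷ Γ) A B (ψ ∷ Δ) X R
    premise≈ = solve 2 (λ l f → (l ⊕ f) ⊕ ∅ ⊜ f ⊕ l) ↭-refl (Γ ++ map var A ++ □* B) (φ ∷ [])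
             , solve 2 (λ r f → (r ⊕ ∅) ⊕ f ⊜ f ⊕ r) ↭-refl (Δ ++ X ++ □* R) (ψ ∷ [])

  □-right : ∀ {φ} → LocalOutcome H Γ A B Δ X (φ ∷ R) → LocalOutcome H Γ A B (□ φ ∷ Δ) X R
  □-right {φ} (proved d) = proved (cyclic-≈ˢ (↭-refl , move) d)
    where
    move : □ φ ∷ Δ ++ X ++ □* R ↭ Δ ++ X ++ □ φ ∷ □* R
    move = solve 4 (λ f d x r → f ⊕ (d ⊕ (x ⊕ r)) ⊜ d ⊕ (x ⊕ (f ⊕ r))) ↭-refl (□ φ ∷ []) Δ X (□* R)
  □-right {φ} (refuted t (Γ✓ , B✓ , Δ✗)) = refuted t (Γ✓ , B✓ , All-resp-↭ move Δ✗)
    where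
    move : Δ ++ X ++ □ φ ∷ □* R ↭ □ φ ∷ Δ ++ X ++ □* R
    move = solve 4 (λ f d x r → d ⊕ (x ⊕ (f ⊕ r)) ⊜ f ⊕ (d ⊕ (x ⊕ r))) ↭-refl (□ φ ∷ []) Δ X (□* R)

weight : Fm → ℕ
weight (var _) = 1
weight ⊥'      = 1
weight (φ ⇒ ψ) = suc (weight φ + weight ψ)
weight (□ φ)   = suc (suc (weight φ))

‖_‖ ‖_‖□ : List Fm → ℕ
‖ Γ ‖  = sum (map weight Γ)
‖ R ‖□ = sum (map (suc ∘ weight) R)

-- A body φ in R stands for □ φ on the right and may later move to Δ (left premise of (□)),
-- so it weighs more than φ and less than □ φ.
μ : List Fm → List Fm → List Fm → ℕ
μ Γ Δ R = ‖ Γ ‖ + ‖ Δ ‖ + ‖ R ‖□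

<-by : ∀ {m n} k → n ≡ suc (m + k) → m < n
<-by {m} k refl = s≤s (m≤m+n m k)

μ-⇒-left₀ : ∀ φ ψ Γ Δ R → μ Γ (φ ∷ Δ) R < μ ((φ ⇒ ψ) ∷ Γ) Δ R
μ-⇒-left₀ φ ψ Γ Δ R = <-by (weight ψ)
  (solve-ℕ 5 (λ a b c d e → (con 1 :+ (a :+ b) :+ c) :+ d :+ e := con 1 :+ ((c :+ (a :+ d) :+ e) :+ b))
     refl (weight φ) (weight ψ) (‖ Γ ‖) (‖ Δ ‖) (‖ R ‖□))

μ-⇒-left₁ : ∀ φ ψ Γ Δ R → μ (ψ ∷ Γ) Δ R < μ ((φ ⇒ ψ) ∷ Γ) Δ R
μ-⇒-left₁ φ ψ Γ Δ R = <-by (weight φ)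
  (solve-ℕ 5 (λ a b c d e → (con 1 :+ (a :+ b) :+ c) :+ d :+ e := con 1 :+ (((b :+ c) :+ d :+ e) :+ a))
     refl (weight φ) (weight ψ) (‖ Γ ‖) (‖ Δ ‖) (‖ R ‖□))

μ-⇒-right : ∀ φ ψ Δ R → μ (φ ∷ []) (ψ ∷ Δ) R < μ [] ((φ ⇒ ψ) ∷ Δ) R
μ-⇒-right φ ψ Δ R = <-by 0
  (solve-ℕ 4 (λ a b d e → (con 1 :+ (a :+ b) :+ d) :+ e
                      := con 1 :+ (((a :+ con 0) :+ (b :+ d) :+ e) :+ con 0))
     refl (weight φ) (weight ψ) (‖ Δ ‖) (‖ R ‖□))

μ-□-right : ∀ φ Δ R → μ [] Δ (φ ∷ R) < μ [] (□ φ ∷ Δ) R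
μ-□-right φ Δ R = <-by 0
  (solve-ℕ 3 (λ a d e → (con 2 :+ a :+ d) :+ e := con 1 :+ ((d :+ (con 1 :+ a :+ e)) :+ con 0))
     refl (weight φ) (‖ Δ ‖) (‖ R ‖□))

μ-□-premise : ∀ φ {R R′} → R ↭ φ ∷ R′ → μ [] (φ ∷ []) R′ < μ [] [] R
μ-□-premise φ {R′ = R′} R↭ = <-by 0 (trans (sum-↭ (↭.map⁺ (suc ∘ weight) R↭))
  (solve-ℕ 2 (λ a e → con 1 :+ a :+ e := con 1 :+ (((a :+ con 0) :+ e) :+ con 0))
     refl (weight φ) (‖ R′ ‖□)))

-- An earlier goal □ Π′ ⇒ φ with Π′ ⊆ Π can serve as the right premise of (□) for □ Π ⇒ φ.
Covered : List BoxGoal → List Fm → Fm → Set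
Covered H Π φ = Any (λ (Π′ , φ′) → φ′ ≡ φ × Π′ ⊆ Π) H

covered? : ∀ H Π φ → Dec (Covered H Π φ)
covered? H Π φ = any? (λ (Π′ , φ′) → (φ′ ≟ φ) ×-dec (Π′ ⊆? Π)) H

module Search (U : List Fm) (U-closed : SubformulaClosed U) where

  ⇒ˡ∈U : ∀ {φ ψ} → (φ ⇒ ψ) ∈ U → φ ∈ U
  ⇒ˡ∈U {φ} φ⇒ψ∈U = U-closed φ⇒ψ∈U (there (∈-++⁺ˡ (∈-subformulas φ)))

  ⇒ʳ∈U : ∀ {φ ψ} → (φ ⇒ ψ) ∈ U → ψ ∈ U
  ⇒ʳ∈U {φ} {ψ} φ⇒ψ∈U = U-closed φ⇒ψ∈U (there (∈-++⁺ʳ (subformulas φ) (∈-subformulas ψ)))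

  □∈U : ∀ {φ} → □ φ ∈ U → φ ∈ U
  □∈U {φ} □φ∈U = U-closed □φ∈U (there (∈-subformulas φ))

  Recursion : List Fm → List BoxGoal → Set
  Recursion Π H = ∀ {Π′ φ} → Unique Π′ → All (λ ψ → □ ψ ∈ U) Π′ → φ ∈ U → Π ⊆ Π′ → ¬ Covered H Π′ φ →
                  Outcome ((Π′ , φ) ∷ H) (boxPremise (Π′ , φ))

  -- Π-pending yields Π ⊆ B at the leaf, so the box context grows along recursive calls.
  record Invariant (Π Γ B Δ X R : List Fm) : Set where
    field
      Γ⊆U      : All (_∈ U) Γ
      Δ⊆U      : All (_∈ U) Δ
      R⊆U      : All (_∈ U) R
      □B⊆U     : All (λ ψ → □ ψ ∈ U) B
      X-atomic : All Atomic X
      Π-pending : ∀ {ψ} → ψ ∈ Π → ψ ∈ B ⊎ □ ψ ∈ Γ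
  open Invariant

  var-left-inv : ∀ {Π p Γ B Δ X R} → Invariant Π (var p ∷ Γ) B Δ X R → Invariant Π Γ B Δ X R
  var-left-inv inv = record { Invariant inv hiding (Γ⊆U; Π-pending)
    ; Γ⊆U = All.tail (Γ⊆U inv)
    ; Π-pending = Sum.map₂ (λ { (here ()) ; (there □ψ∈) → □ψ∈ }) ∘ Π-pending inv }

  ⇒-left-inv₀ : ∀ {Π φ ψ Γ B Δ X R} → Invariant Π ((φ ⇒ ψ) ∷ Γ) B Δ X R → Invariant Π Γ B (φ ∷ Δ) X R
  ⇒-left-inv₀ inv = record { Invariant inv hiding (Γ⊆U; Δ⊆U; Π-pending)
    ; Γ⊆U = All.tail (Γ⊆U inv)
    ; Δ⊆U = ⇒ˡ∈U (All.head (Γ⊆U inv)) ∷ Δ⊆U inv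
    ; Π-pending = Sum.map₂ (λ { (here ()) ; (there □ψ∈) → □ψ∈ }) ∘ Π-pending inv }

  ⇒-left-inv₁ : ∀ {Π φ ψ Γ B Δ X R} → Invariant Π ((φ ⇒ ψ) ∷ Γ) B Δ X R → Invariant Π (ψ ∷ Γ) B Δ X R
  ⇒-left-inv₁ inv = record { Invariant inv hiding (Γ⊆U; Π-pending)
    ; Γ⊆U = ⇒ʳ∈U (All.head (Γ⊆U inv)) ∷ All.tail (Γ⊆U inv)
    ; Π-pending = Sum.map₂ (λ { (here ()) ; (there □ψ∈) → there □ψ∈ }) ∘ Π-pending inv }

  ⇒-right-inv : ∀ {Π B φ ψ Δ X R} → Invariant Π [] B ((φ ⇒ ψ) ∷ Δ) X R → Invariant Π (φ ∷ []) B (ψ ∷ Δ) X R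
  ⇒-right-inv inv = record { Invariant inv hiding (Γ⊆U; Δ⊆U; Π-pending)
    ; Γ⊆U = ⇒ˡ∈U (All.head (Δ⊆U inv)) ∷ []
    ; Δ⊆U = ⇒ʳ∈U (All.head (Δ⊆U inv)) ∷ All.tail (Δ⊆U inv)
    ; Π-pending = Sum.map₂ there ∘ Π-pending inv }

  □-left-inv : ∀ {Π φ Γ B Δ X R} → Invariant Π (□ φ ∷ Γ) B Δ X R → Invariant Π (φ ∷ Γ) (φ ∷ B) Δ X R
  □-left-inv {φ = φ} inv = record { Invariant inv hiding (Γ⊆U; □B⊆U; Π-pending)
    ; Γ⊆U  = □∈U (All.head (Γ⊆U inv)) ∷ All.tail (Γ⊆U inv)
    ; □B⊆U = All.head (Γ⊆U inv) ∷ □B⊆U inv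
    ; Π-pending = unfold-pending ∘ Π-pending inv }
    where
    unfold-pending : ∀ {ψ B Γ} → ψ ∈ B ⊎ □ ψ ∈ □ φ ∷ Γ → ψ ∈ φ ∷ B ⊎ □ ψ ∈ φ ∷ Γ
    unfold-pending (inj₁ ψ∈B)          = inj₁ (there ψ∈B)
    unfold-pending (inj₂ (here refl))  = inj₁ (here refl)
    unfold-pending (inj₂ (there □ψ∈Γ)) = inj₂ (there □ψ∈Γ)

  atom-right-inv : ∀ {Π B χ Δ X R} → Atomic χ → Invariant Π [] B (χ ∷ Δ) X R → Invariant Π [] B Δ (χ ∷ X) R
  atom-right-inv χ-atomic inv = record { Invariant inv hiding (Δ⊆U; X-atomic)
    ; Δ⊆U = All.tail (Δ⊆U inv)
    ; X-atomic = χ-atomic ∷ X-atomic inv }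

  □-right-inv : ∀ {Π Γ B φ Δ X R} → Invariant Π Γ B (□ φ ∷ Δ) X R → Invariant Π Γ B Δ X (φ ∷ R)
  □-right-inv inv = record { Invariant inv hiding (Δ⊆U; R⊆U)
    ; Δ⊆U = All.tail (Δ⊆U inv)
    ; R⊆U = □∈U (All.head (Δ⊆U inv)) ∷ R⊆U inv }

  □-premise-inv : ∀ {Π B X R φ R′} → R ↭ φ ∷ R′ → Invariant Π [] B [] X R → Invariant Π [] B (φ ∷ []) X R′
  □-premise-inv R↭ inv = record { Invariant inv hiding (Δ⊆U; R⊆U)
    ; Δ⊆U = All.head (All-resp-↭ R↭ (R⊆U inv)) ∷ []
    ; R⊆U = All.tail (All-resp-↭ R↭ (R⊆U inv)) }

  -- At a leaf only atoms and boxes remain.  Each □ φ on the right is tried with (□); if every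
  -- right premise is refuted, the refuting trees become the children of a countermodel.
  module Leaf {H Π} (H-unique : All (Unique ∘ proj₁) H) (recurse : Recursion Π H)
              {A : List ℕ} {B X R : List Fm} (inv : Invariant Π [] B [] X R)
              (left-premise : ∀ {φ R′} → R ↭ φ ∷ R′ → LocalOutcome H [] A B (φ ∷ []) X R′) where

    axiom : ∀ {q} → q ∈ A → var q ∈ X → Cyclic H (sequent [] A B [] X R)
    axiom {q} q∈A q∈X with ∈⇒↭ q∈A | ∈⇒↭ q∈X
    ... | A′ , A↭ | X′ , X↭ = c-ax (map var A′ ++ □* B , X′ ++ □* R) q conclusion≈
      where
      conclusion≈ : sequent [] A B [] X R ≈ˢ ((map var A′ ++ □* B , X′ ++ □* R) ,• var q ,∘ var q)
      conclusion≈ =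
          ↭-trans (↭.++⁺ʳ (□* B) (↭.map⁺ var A↭))
            (solve 3 (λ v a b → (v ⊕ a) ⊕ b ⊜ ((a ⊕ b) ⊕ v) ⊕ ∅) ↭-refl (var q ∷ []) (map var A′) (□* B))
        , ↭-trans (↭.++⁺ʳ (□* R) X↭)
            (solve 3 (λ v x r → (v ⊕ x) ⊕ r ⊜ ((x ⊕ r) ⊕ ∅) ⊕ v) ↭-refl (var q ∷ []) X′ (□* R))

    commit : ∀ {φ Π′} → φ ∈ R → Unique Π′ → Π′ ⊆ B → BoxPremise H (Π′ , φ) → LocalOutcome H [] A B [] X R
    commit {φ} {Π′} φ∈R Π′-unique Π′⊆B right with ∈⇒↭ φ∈R | unique-⊆⇒↭ Π′-unique Π′⊆B
    ... | R′ , R↭ | B′ , B↭ with left-premise R↭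
    ...   | proved d = proved (c-box S Π′ φ conclusion≈ (cyclic-≈ˢ premise≈ d) right)
      where
      S = (map var A ++ □* B′ , X ++ □* R′)
      □B↭ : □* B ↭ □* Π′ ++ □* B′
      □B↭ = ↭-trans (↭.map⁺ □_ B↭) (↭-reflexive (map-++ □_ Π′ B′))
      conclusion≈ : sequent [] A B [] X R ≈ˢ (S ,•* □* Π′ ,∘ □ φ)
      conclusion≈ =
          ↭-trans (↭.++⁺ˡ (map var A) □B↭)
            (solve 3 (λ a p r → a ⊕ (p ⊕ r) ⊜ ((a ⊕ r) ⊕ p) ⊕ ∅) ↭-refl (map var A) (□* Π′) (□* B′))
        , ↭-trans (↭.++⁺ˡ X (↭.map⁺ □_ R↭))
            (solve 3 (λ x f r → x ⊕ (f ⊕ r) ⊜ ((x ⊕ r) ⊕ ∅) ⊕ f) ↭-refl X (□ φ ∷ []) (□* R′))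
      premise≈ : (S ,•* □* Π′ ,∘ φ) ≈ˢ sequent [] A B (φ ∷ []) X R′
      premise≈ =
          ↭-trans (solve 3 (λ a p r → ((a ⊕ r) ⊕ p) ⊕ ∅ ⊜ a ⊕ (p ⊕ r)) ↭-refl (map var A) (□* Π′) (□* B′))
            (↭.++⁺ˡ (map var A) (↭-sym □B↭))
        , solve 3 (λ x f r → ((x ⊕ r) ⊕ ∅) ⊕ f ⊜ f ⊕ (x ⊕ r)) ↭-refl X (φ ∷ []) (□* R′)
    ...   | refuted t (A✓ , B✓ , t⊮φ ∷ Δ✗) = refuted t (A✓ , B✓ , All-resp-↭ move (t⊮□φ ∷ Δ✗))
      where
      t⊮□φ : t ⊮ □ φ
      t⊮□φ (tφ ∷ _) = t⊮φ tφ
      move : □ φ ∷ X ++ □* R′ ↭ X ++ □* R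
      move = ↭-trans (↭-sym (shift (□ φ) X (□* R′))) (↭.++⁺ˡ X (↭-sym (↭.map⁺ □_ R↭)))

    Π⁺ : List Fm
    Π⁺ = deduplicate _≟_ B

    Π⊆Π⁺ : Π ⊆ Π⁺
    Π⊆Π⁺ ψ∈Π with Π-pending inv ψ∈Π
    ... | inj₁ ψ∈B = ∈-deduplicate⁺ _≟_ ψ∈B

    Child : Fm → Set
    Child φ = ∃[ v ] (All (λ ψ → v ⊩ □ ψ) B × v ⊮ φ)

    attempt : ∀ {φ} → φ ∈ R → LocalOutcome H [] A B [] X R ⊎ Child φ
    attempt {φ} φ∈R with covered? H Π⁺ φ
    ... | yes covered with find covered
    ...   | _ , G∈H , refl , Π′⊆Π⁺ =
            inj₁ (commit φ∈R (All.lookup H-unique G∈H) (∈-deduplicate⁻ _≟_ B ∘ Π′⊆Π⁺) (back G∈H))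
    attempt {φ} φ∈R | no uncovered
      with recurse (deduplicate-! _≟_ B) (deduplicate⁺ _≟_ (□B⊆U inv)) (All.lookup (R⊆U inv) φ∈R)
                   Π⊆Π⁺ uncovered
    ... | proved d = inj₁ (commit φ∈R (deduplicate-! _≟_ B) (∈-deduplicate⁻ _≟_ B) (new d))
    ... | refuted v (□Π⁺✓ , v⊮φ ∷ []) =
          inj₂ (v , All.tabulate (All.lookup (map⁻ (++⁻ˡ (□* Π⁺) □Π⁺✓)) ∘ ∈-deduplicate⁺ _≟_) , v⊮φ)

    countermodel : ¬ Any (λ q → var q ∈ X) A → All Child R → LocalOutcome H [] A B [] X R
    countermodel no-axiom children with collect children
    ... | ks , ks-□B , refuters = refuted (tree A ks) (map⁺ (All.tabulate id) , B✓ , ++⁺ X✗ R✗)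
      where
      B✓ : All (tree A ks ⊩↓_) B
      B✓ = All.tabulate λ ψ∈B → □-forest⇒nodes (All.map (λ k□B → All.lookup k□B ψ∈B) ks-□B)
      X✗ : All (tree A ks ⊮_) X
      X✗ = All.tabulate λ {x} x∈X → atom-false (All.lookup (X-atomic inv) x∈X) x∈X
        where
        atom-false : ∀ {x} → Atomic x → x ∈ X → tree A ks ⊮ x
        atom-false (is-var q) q∈X q∈A = no-axiom (lose q∈A q∈X)
        atom-false is-⊥       _   ()
      R✗ : All (tree A ks ⊮_) (□* R)
      R✗ = map⁺ (All.map (λ (k , k∈ , k⊮φ) → child-refutes-□ k∈ k⊮φ) refuters)

    outcome : LocalOutcome H [] A B [] X R
    outcome with any? (λ q → var q ∈? X) A
    ... | yes axiom-instance = let _ , q∈A , q∈X = find axiom-instance in proved (axiom q∈A q∈X)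
    ... | no no-axiom with first-or-all (All.tabulate attempt)
    ...   | inj₁ found    = found
    ...   | inj₂ children = countermodel no-axiom children

  module Local {H Π} (H-unique : All (Unique ∘ proj₁) H) (recurse : Recursion Π H) where

    search : ∀ Γ A B Δ X R → Invariant Π Γ B Δ X R → Acc _<_ (μ Γ Δ R) → LocalOutcome H Γ A B Δ X R
    search (var p ∷ Γ) A B Δ X R inv (acc rec) =
      var-left (search Γ (p ∷ A) B Δ X R (var-left-inv inv) (rec ≤-refl))
    search (⊥' ∷ Γ) A B Δ X R inv _ = ⊥-left
    search ((φ ⇒ ψ) ∷ Γ) A B Δ X R inv (acc rec) =
      ⇒-left (search Γ A B (φ ∷ Δ) X R (⇒-left-inv₀ inv) (rec (μ-⇒-left₀ φ ψ Γ Δ R)))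
             (search (ψ ∷ Γ) A B Δ X R (⇒-left-inv₁ inv) (rec (μ-⇒-left₁ φ ψ Γ Δ R)))
    search (□ φ ∷ Γ) A B Δ X R inv (acc rec) =
      □-left (search (φ ∷ Γ) A (φ ∷ B) Δ X R (□-left-inv inv) (rec (m≤n⇒m≤1+n ≤-refl)))
    search [] A B (var p ∷ Δ) X R inv (acc rec) =
      atom-right (search [] A B Δ (var p ∷ X) R (atom-right-inv (is-var p) inv) (rec ≤-refl))
    search [] A B (⊥' ∷ Δ) X R inv (acc rec) =
      atom-right (search [] A B Δ (⊥' ∷ X) R (atom-right-inv is-⊥ inv) (rec ≤-refl))
    search [] A B ((φ ⇒ ψ) ∷ Δ) X R inv (acc rec) =
      ⇒-right (search (φ ∷ []) A B (ψ ∷ Δ) X R (⇒-right-inv inv) (rec (μ-⇒-right φ ψ Δ R)))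
    search [] A B (□ φ ∷ Δ) X R inv (acc rec) =
      □-right (search [] A B Δ X (φ ∷ R) (□-right-inv inv) (rec (μ-□-right φ Δ R)))
    search [] A B [] X R inv (acc rec) = Leaf.outcome H-unique recurse inv left-premise
      where
      left-premise : ∀ {φ R′} → R ↭ φ ∷ R′ → LocalOutcome H [] A B (φ ∷ []) X R′
      left-premise {φ} {R′} R↭ =
        search [] A B (φ ∷ []) X R′ (□-premise-inv R↭ inv) (rec (μ-□-premise φ R↭))

  covered-mono : ∀ {H Π Π′ φ} → Π ⊆ Π′ → Covered H Π φ → Covered H Π′ φ
  covered-mono Π⊆Π′ = Any.map λ (same , ⊆Π) → same , Π⊆Π′ ∘ ⊆Π

  missing : List Fm → ℕ
  missing Π = count (λ u → ¬? (u ∈? Π)) U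

  uncovered : List BoxGoal → List Fm → ℕ
  uncovered H Π = count (λ φ → ¬? (covered? H Π φ)) U

  _≺_ : ℕ × ℕ → ℕ × ℕ → Set
  _≺_ = ×-Lex _≡_ _<_ _<_

  measure : List Fm → List BoxGoal → ℕ × ℕ
  measure Π H = missing Π , uncovered H Π

  -- The box context only grows along recursive calls; if it does not grow as a set, the new
  -- goal was uncovered before and is covered afterwards.
  measure-decreases : ∀ {Π Π′ φ H} → Π ⊆ Π′ → All (λ ψ → □ ψ ∈ U) Π′ → φ ∈ U → ¬ Covered H Π′ φ →
                      measure Π′ ((Π′ , φ) ∷ H) ≺ measure Π H
  measure-decreases {Π} {Π′} {φ} {H} Π⊆Π′ □Π′⊆U φ∈U new-goal with All.all? (_∈? Π) Π′
  ... | yes Π′⊆Π = inj₂ (same-missing , fewer-uncovered)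
    where
    same-missing : missing Π′ ≡ missing Π
    same-missing = count-cong _ _ (λ u∉Π′ u∈Π → u∉Π′ (Π⊆Π′ u∈Π)) (λ u∉Π u∈Π′ → u∉Π (All.lookup Π′⊆Π u∈Π′)) U
    fewer-uncovered : uncovered ((Π′ , φ) ∷ H) Π′ < uncovered H Π
    fewer-uncovered = count-strict _ _ (λ ¬cov′ cov → ¬cov′ (there (covered-mono Π⊆Π′ cov))) U φ∈U
                        (new-goal ∘ covered-mono Π⊆Π′) (λ ¬cov → ¬cov (here (refl , id)))
  ... | no Π′⊈Π with find (¬All⇒Any¬ (_∈? Π) Π′ Π′⊈Π)
  ...   | ψ , ψ∈Π′ , ψ∉Π =
          inj₁ (count-strict _ _ (λ u∉Π′ u∈Π → u∉Π′ (Π⊆Π′ u∈Π)) U ψ∈U ψ∉Π (λ ψ∉Π′ → ψ∉Π′ ψ∈Π′))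
    where
    ψ∈U : ψ ∈ U
    ψ∈U = □∈U (All.lookup □Π′⊆U ψ∈Π′)

  prove-box-goal : ∀ {Π φ H} → Unique Π → All (λ ψ → □ ψ ∈ U) Π → φ ∈ U → All (Unique ∘ proj₁) H →
                   Acc _≺_ (measure Π ((Π , φ) ∷ H)) → Outcome ((Π , φ) ∷ H) (boxPremise (Π , φ))
  prove-box-goal {Π} {φ} {H} Π-unique □Π⊆U φ∈U H-unique (acc rec)
    with Local.search (Π-unique ∷ H-unique) recurse (□* Π) [] [] (φ ∷ []) [] [] inv (<-wellFounded _)
    where
    recurse : Recursion Π ((Π , φ) ∷ H)
    recurse Π′-unique □Π′⊆U φ′∈U Π⊆Π′ new-goal =
      prove-box-goal Π′-unique □Π′⊆U φ′∈U (Π-unique ∷ H-unique)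
                     (rec (measure-decreases Π⊆Π′ □Π′⊆U φ′∈U new-goal))
    inv : Invariant Π (□* Π) [] (φ ∷ []) [] []
    inv = record { Γ⊆U = map⁺ □Π⊆U ; Δ⊆U = φ∈U ∷ [] ; R⊆U = [] ; □B⊆U = [] ; X-atomic = []
                 ; Π-pending = inj₂ ∘ ∈-map⁺ □_ }
  ... | proved d                 = proved d
  ... | refuted t (Γ✓ , [] , Δ✗) = refuted t (Γ✓ , Δ✗)

search-sequent : ∀ S → Outcome [] S
search-sequent (Γ , Δ) with Local.search [] recurse Γ [] [] Δ [] [] inv (<-wellFounded _)
  where
  open Search (subformulas* (Γ ++ Δ)) (subformulas*-closed (Γ ++ Δ))
  recurse : Recursion [] []
  recurse Π-unique □Π⊆U φ∈U _ _ =
    prove-box-goal Π-unique □Π⊆U φ∈U [] (×-wellFounded <-wellFounded <-wellFounded _)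
  inv : Invariant [] Γ [] Δ [] []
  inv = record { Γ⊆U = All.tabulate (⊆-subformulas* (Γ ++ Δ) ∘ ∈-++⁺ˡ)
               ; Δ⊆U = All.tabulate (⊆-subformulas* (Γ ++ Δ) ∘ ∈-++⁺ʳ Γ)
               ; R⊆U = [] ; □B⊆U = [] ; X-atomic = [] ; Π-pending = λ () }
... | proved d                 = proved (cyclic-≈ˢ (↭-sym (++-identityʳ Γ) , ↭-sym (++-identityʳ Δ)) d)
... | refuted t (Γ✓ , [] , Δ✗) = refuted t (++⁻ˡ Γ Γ✓ , ++⁻ˡ Δ Δ✗)

theorem4p6 : ∀ (S : Seq) → Proof GrzCut S → Proof Grz S
theorem4p6 S P with search-sequent S
... | proved d       = Unfolding.unfold d
... | refuted t t⊭S = ⊥-elim (soundness P t t⊭S)
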